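{- Let $V$ be a finite set, let $\mathcal{P}$, $\mathcal{P}'$ be partitions of $V$, and let $P_s \neq P_t \in \mathcal{P}$. Let $\mathcal{S}_s, \mathcal{S}_t \subseteq \mathcal{P}$ with $P_s \in \mathcal{S}_s$, $P_t \in \mathcal{S}_t$ and $\mathcal{S}_s \cap \mathcal{S}_t = \emptyset$, and let $\mathcal{S} \subseteq \mathcal{P}$ with $\mathcal{S} \supseteq \mathcal{S}_s$ and $\mathcal{S} \cap \mathcal{S}_t = \emptyset$. Then \[ b(\mathcal{S}_s, \mathcal{S}_t) := \sum_{P' \in \mathcal{P}'} \min\{\vert U_{\mathcal{S}_s} \cap P' \vert, \vert U_{\mathcal{S}_t} \cap P' \vert\} \leq \phi_{\mathcal{P}'}(\mathcal{S}). \]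
   Context: $U_{\mathcal{S}}$ denotes the union of the members of $\mathcal{S}$; $\vert\cdot\vert$ is cardinality (or total weight, if elements carry nonnegative weights). $\phi_{\mathcal{P}'}(\mathcal{S}) := \min_{\mathcal{S}' \subseteq \mathcal{P}'} \vert U_{\mathcal{S}} \triangle U_{\mathcal{S}'} \vert$, $\triangle$ = symmetric difference. -}

module Defs where

open import Data.Nat using (ℕ; zero; suc; _⊔_; _⊓_)
open import Data.Fin using (Fin; _≟_)
open import Data.Fin.Subset using (Subset; inside; outside; ⊥; _∩_; _∪_; _─_; ∣_∣)
open import Data.Vec using (Vec; []; _∷_; tabulate; lookup; sum)
open import Data.List using (List; [_]; _++_; map; foldr)
open import Relation.Nullary.Decidable using (does)
open import Data.Bool using (if_then_else_)

-- A partition of V = Fin n into k blocks is given by a block-labelling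
-- map  lab : Fin n → Fin k  (block j = fibre of j).  Surjectivity of lab
-- (nonempty blocks) is imposed in the statement.

block : ∀ {n k} → (Fin n → Fin k) → Fin k → Subset n
block lab j = tabulate λ v → if does (lab v ≟ j) then inside else outside

U : ∀ {n k} → (Fin n → Fin k) → Subset k → Subset n
U lab S = tabulate λ v → lookup S (lab v)

_△_ : ∀ {n} → Subset n → Subset n → Subset n
A △ B = (A ─ B) ∪ (B ─ A)

allSubsets : ∀ k → List (Subset k)
allSubsets zero = [ [] ]
allSubsets (suc k) = map (inside ∷_) (allSubsets k) ++ map (outside ∷_) (allSubsets k)

-- φ_{𝒫'}(S) = min over S' ⊆ 𝒫' of |U_S △ U_{S'}|
-- (the empty family S' = ⊥ is used as the seed; it is also in the list)
φ : ∀ {n k k'} → (Fin n → Fin k) → (Fin n → Fin k') → Subset k → ℕ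
φ {k' = k'} lab lab' S =
  foldr (λ S' m → ∣ U lab S △ U lab' S' ∣ ⊓ m) ∣ U lab S △ U lab' ⊥ ∣ (allSubsets k')

b : ∀ {n k k'} → (Fin n → Fin k) → (Fin n → Fin k') → Subset k → Subset k → ℕ
b {k' = k'} lab lab' Ss St =
  sum (tabulate {n = k'} λ j → ∣ U lab Ss ∩ block lab' j ∣ ⊓ ∣ U lab St ∩ block lab' j ∣)

-- Fix S' ⊆ 𝒫' and a block P' of 𝒫'.  If P' ∈ S', every point of U_{S_t} ∩ P'
-- lies in U_{S'} but not in U_S (as S ∩ S_t = ∅); if P' ∉ S', every point of
-- U_{S_s} ∩ P' lies in U_S (as S_s ⊆ S) but not in U_{S'}.  Either way the
-- smaller of the two counts is at most |(U_S △ U_{S'}) ∩ P'|, and summing over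
-- the blocks of the partition 𝒫' gives |U_S △ U_{S'}|.
module Submission where

open import Defs
import Algebra.Properties.CommutativeMonoid.Sum as CommutativeMonoidSum
open import Data.Bool using (Bool; true; false; _∧_; if_then_else_)
open import Data.Bool.Properties using (∧-identityʳ; ∧-zeroʳ)
open import Data.Fin using (Fin; zero; suc; _≟_)
open import Data.Fin.Subset
  using (Subset; Side; inside; outside; _∈_; _∉_; _⊆_; _∩_; ∣_∣; Empty)
  renaming (⊥ to ∅)
open import Data.Fin.Subset.Properties
  using (_∈?_; p⊆q⇒∣p∣≤∣q∣; x∈p∩q⁺; x∈p∩q⁻; x∈p∪q⁺; x∈p∧x∉q⇒x∈p─q)
open import Data.List using ([]; _∷_; foldr)
open import Data.Nat using (ℕ; zero; suc; _+_; _⊓_; _≤_; z≤n)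
open import Data.Nat.Properties
  using ( +-0-commutativeMonoid; +-mono-≤; +-identityʳ; ⊓-glb; m≤n⇒m⊓o≤n; m≤n⇒o⊓m≤n
        ; module ≤-Reasoning)
open import Data.Product using (_,_)
open import Data.Sum using (inj₁; inj₂)
open import Data.Vec using ([]; _∷_; tabulate; lookup; sum)
open import Data.Vec.Properties using (lookup∘tabulate; []=⇒lookup; lookup⇒[]=)
open import Function.Definitions using (Surjective)
open import Relation.Binary.PropositionalEquality
  using (_≡_; _≢_; refl; sym; trans; cong; cong₂; subst; module ≡-Reasoning)
open import Relation.Nullary using (does; yes; no)

open CommutativeMonoidSum +-0-commutativeMonoid
  using (sum-syntax; ∑-distrib-+; sum-cong-≗; sum-replicate-zero)
  renaming (sum to ∑)

sum-tabulate : ∀ {n} (f : Fin n → ℕ) → sum (tabulate f) ≡ ∑ f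
sum-tabulate {zero} f = refl
sum-tabulate {suc n} f = cong (f zero +_) (sum-tabulate (λ i → f (suc i)))

∑-mono-≤ : ∀ {n} {f g : Fin n → ℕ} → (∀ i → f i ≤ g i) → ∑ f ≤ ∑ g
∑-mono-≤ {zero} f≤g = z≤n
∑-mono-≤ {suc n} f≤g = +-mono-≤ (f≤g zero) (∑-mono-≤ (λ i → f≤g (suc i)))

∑-does-≟ : ∀ {k} (w : Fin k) (f : Bool → ℕ) → f false ≡ 0 →
           ∑[ j < k ] f (does (w ≟ j)) ≡ f true
∑-does-≟ {suc k} zero f f0≡0 = begin
  f true + ∑[ j < k ] f false  ≡⟨ cong (f true +_) (sum-cong-≗ {k} (λ _ → f0≡0)) ⟩
  f true + ∑[ j < k ] 0        ≡⟨ cong (f true +_) (sum-replicate-zero k) ⟩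
  f true + 0                   ≡⟨ +-identityʳ (f true) ⟩
  f true                       ∎
  where open ≡-Reasoning
∑-does-≟ {suc k} (suc w) f f0≡0 =
  trans (cong (_+ ∑[ j < k ] f (does (w ≟ j))) f0≡0) (∑-does-≟ w f f0≡0)

∣x∷p∣≡∣x∣+∣p∣ : ∀ {n} (x : Side) (p : Subset n) → ∣ x ∷ p ∣ ≡ ∣ x ∷ [] ∣ + ∣ p ∣
∣x∷p∣≡∣x∣+∣p∣ inside p = refl
∣x∷p∣≡∣x∣+∣p∣ outside p = refl

∑-∣∩block∣ : ∀ {n k} (lab : Fin n → Fin k) (p : Subset n) →
             ∑[ j < k ] ∣ p ∩ block lab j ∣ ≡ ∣ p ∣
∑-∣∩block∣ {k = k} lab [] = sum-replicate-zero k
∑-∣∩block∣ {k = k} lab (x ∷ p) = begin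
  ∑[ j < k ] ∣ (x ∷ p) ∩ block lab j ∣
    ≡⟨ sum-cong-≗ {k} (λ j → ∣x∷p∣≡∣x∣+∣p∣ (x ∧ side j) (p ∩ block lab₊ j)) ⟩
  ∑[ j < k ] (atZero (does (lab zero ≟ j)) + ∣ p ∩ block lab₊ j ∣)
    ≡⟨ ∑-distrib-+ {k} _ _ ⟩
  ∑[ j < k ] atZero (does (lab zero ≟ j)) + ∑[ j < k ] ∣ p ∩ block lab₊ j ∣
    ≡⟨ cong₂ _+_ (∑-does-≟ (lab zero) atZero (cong ∣_∣ (cong (_∷ []) (∧-zeroʳ x))))
                 (∑-∣∩block∣ lab₊ p) ⟩
  atZero true + ∣ p ∣
    ≡⟨ cong (λ y → ∣ y ∷ [] ∣ + ∣ p ∣) (∧-identityʳ x) ⟩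
  ∣ x ∷ [] ∣ + ∣ p ∣
    ≡⟨ sym (∣x∷p∣≡∣x∣+∣p∣ x p) ⟩
  ∣ x ∷ p ∣ ∎
  where
  open ≡-Reasoning
  lab₊ : Fin _ → Fin k
  lab₊ v = lab (suc v)
  side : Fin k → Side
  side j = if does (lab zero ≟ j) then inside else outside
  atZero : Bool → ℕ
  atZero b = ∣ (x ∧ (if b then inside else outside)) ∷ [] ∣

∈tabulate⁻ : ∀ {n} {f : Fin n → Side} {v : Fin n} → v ∈ tabulate f → f v ≡ inside
∈tabulate⁻ {f = f} {v} v∈ = trans (sym (lookup∘tabulate f v)) ([]=⇒lookup v∈)

∈tabulate⁺ : ∀ {n} {f : Fin n → Side} {v : Fin n} → f v ≡ inside → v ∈ tabulate f
∈tabulate⁺ {f = f} {v} fv≡inside =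
  lookup⇒[]= v (tabulate f) (trans (lookup∘tabulate f v) fv≡inside)

module _ {n k : ℕ} {lab : Fin n → Fin k} {v : Fin n} where

  ∈U⁻ : ∀ {S} → v ∈ U lab S → lab v ∈ S
  ∈U⁻ {S} v∈U = lookup⇒[]= (lab v) S (∈tabulate⁻ v∈U)

  ∈U⁺ : ∀ {S} → lab v ∈ S → v ∈ U lab S
  ∈U⁺ labv∈S = ∈tabulate⁺ ([]=⇒lookup labv∈S)

  ∈block⁻ : ∀ {j} → v ∈ block lab j → lab v ≡ j
  ∈block⁻ {j} v∈block with lab v ≟ j | ∈tabulate⁻ v∈block
  ... | yes labv≡j | _ = labv≡j
  ... | no _ | ()

module _ {n k k' : ℕ} (lab : Fin n → Fin k) (lab' : Fin n → Fin k')
         {S : Subset k} {S' : Subset k'} {j : Fin k'} where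

  U∩block⊆U'─U : ∀ {T} → Empty (S ∩ T) → j ∈ S' →
                 U lab T ∩ block lab' j ⊆ (U lab S △ U lab' S') ∩ block lab' j
  U∩block⊆U'─U {T} S∩T≡∅ j∈S' v∈ with x∈p∩q⁻ (U lab T) _ v∈
  ... | v∈UT , v∈block = x∈p∩q⁺ (x∈p∪q⁺ (inj₂ (x∈p∧x∉q⇒x∈p─q v∈U'S' v∉US)) , v∈block)
    where
    v∈U'S' = ∈U⁺ (subst (_∈ S') (sym (∈block⁻ {lab = lab'} v∈block)) j∈S')
    v∉US : _ ∉ U lab S
    v∉US v∈US = S∩T≡∅ (_ , x∈p∩q⁺ (∈U⁻ v∈US , ∈U⁻ v∈UT))

  U∩block⊆U─U' : ∀ {T} → T ⊆ S → j ∉ S' →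
                 U lab T ∩ block lab' j ⊆ (U lab S △ U lab' S') ∩ block lab' j
  U∩block⊆U─U' {T} T⊆S j∉S' v∈ with x∈p∩q⁻ (U lab T) _ v∈
  ... | v∈UT , v∈block = x∈p∩q⁺ (x∈p∪q⁺ (inj₁ (x∈p∧x∉q⇒x∈p─q v∈US v∉U'S')) , v∈block)
    where
    v∈US = ∈U⁺ (T⊆S (∈U⁻ v∈UT))
    v∉U'S' : _ ∉ U lab' S'
    v∉U'S' v∈U'S' = j∉S' (subst (_∈ S') (∈block⁻ {lab = lab'} v∈block) (∈U⁻ v∈U'S'))

  ∣U∩block∣⊓∣U∩block∣≤∣△∩block∣ : ∀ {Ss St} → Ss ⊆ S → Empty (S ∩ St) →
    ∣ U lab Ss ∩ block lab' j ∣ ⊓ ∣ U lab St ∩ block lab' j ∣ ≤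
    ∣ (U lab S △ U lab' S') ∩ block lab' j ∣
  ∣U∩block∣⊓∣U∩block∣≤∣△∩block∣ Ss⊆S S∩St≡∅ with j ∈? S'
  ... | yes j∈S' = m≤n⇒o⊓m≤n _ (p⊆q⇒∣p∣≤∣q∣ (U∩block⊆U'─U S∩St≡∅ j∈S'))
  ... | no j∉S' = m≤n⇒m⊓o≤n _ (p⊆q⇒∣p∣≤∣q∣ (U∩block⊆U─U' Ss⊆S j∉S'))

b≤∣U△U'∣ : ∀ {n k k'} (lab : Fin n → Fin k) (lab' : Fin n → Fin k') {Ss St S : Subset k} →
           Ss ⊆ S → Empty (S ∩ St) → ∀ S' → b lab lab' Ss St ≤ ∣ U lab S △ U lab' S' ∣
b≤∣U△U'∣ {k' = k'} lab lab' {Ss} {St} {S} Ss⊆S S∩St≡∅ S' = begin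
  b lab lab' Ss St
    ≡⟨ sum-tabulate {k'} _ ⟩
  ∑[ j < k' ] (∣ U lab Ss ∩ block lab' j ∣ ⊓ ∣ U lab St ∩ block lab' j ∣)
    ≤⟨ ∑-mono-≤ (λ j → ∣U∩block∣⊓∣U∩block∣≤∣△∩block∣ lab lab' {S' = S'} {j} Ss⊆S S∩St≡∅) ⟩
  ∑[ j < k' ] ∣ (U lab S △ U lab' S') ∩ block lab' j ∣
    ≡⟨ ∑-∣∩block∣ lab' (U lab S △ U lab' S') ⟩
  ∣ U lab S △ U lab' S' ∣ ∎
  where open ≤-Reasoning

≤-foldr-⊓ : ∀ {A : Set} (f : A → ℕ) {m e : ℕ} → m ≤ e → (∀ a → m ≤ f a) →
            ∀ xs → m ≤ foldr (λ a r → f a ⊓ r) e xs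
≤-foldr-⊓ f m≤e m≤f [] = m≤e
≤-foldr-⊓ f m≤e m≤f (a ∷ xs) = ⊓-glb (m≤f a) (≤-foldr-⊓ f m≤e m≤f xs)

≤φ : ∀ {n k k'} (lab : Fin n → Fin k) (lab' : Fin n → Fin k') {S : Subset k} {m : ℕ} →
     (∀ S' → m ≤ ∣ U lab S △ U lab' S' ∣) → m ≤ φ lab lab' S
≤φ {k' = k'} lab lab' m≤ = ≤-foldr-⊓ _ (m≤ ∅) m≤ (allSubsets k')

proposition6 : (n k k' : ℕ) (lab : Fin n → Fin k) (lab' : Fin n → Fin k')
    → Surjective _≡_ _≡_ lab → Surjective _≡_ _≡_ lab'
    → (s t : Fin k) → s ≢ t
    → (Ss St S : Subset k)
    → s ∈ Ss → t ∈ St → Empty (Ss ∩ St)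
    → Ss ⊆ S → Empty (S ∩ St)
    → b lab lab' Ss St ≤ φ lab lab' S
proposition6 _ _ _ lab lab' _ _ _ _ _ Ss St S _ _ _ Ss⊆S S∩St≡∅ =
  ≤φ lab lab' {S} (b≤∣U△U'∣ lab lab' {St = St} Ss⊆S S∩St≡∅)
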